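{- Let $\boldsymbol\Gamma\in\Gamma\mathsf{Dom}$ (with $k$ components) and $\mathbf A,\mathbf B\in\mathrm{Su}(\mathbb N)^k$. Then: (a) $\mathbf A\le\mathbf B$ implies $\boldsymbol\Gamma(\mathbf A)\le\boldsymbol\Gamma(\mathbf B)$; (b) $\mathcal N(\mathbf A)=\mathcal N(\mathbf B)$ implies $\mathcal N(\boldsymbol\Gamma(\mathbf A))=\mathcal N(\boldsymbol\Gamma(\mathbf B))$; (c) $\mathbf A\le\mathbf B$ implies $\mathcal N(\boldsymbol\Gamma(\mathbf A))\supseteq\mathcal N(\boldsymbol\Gamma(\mathbf B))$; (d) $\mathcal N(\boldsymbol\Gamma^{(k)}(\boldsymbol\emptyset))=\mathcal N(\boldsymbol\Gamma^{(k+n)}(\boldsymbol\emptyset))$ for all $n\ge 0$.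
   Context: $\mathbb N=\{0,1,\dots\}$, $\mathrm{Su}(\mathbb N)$ is the set of subsets of $\mathbb N$. For $A,B\subseteq\mathbb N$, $A+B=\{a+b\}$ (empty if either is empty); $n\star B=\{0\}$ if $n=0$ and $B+\cdots+B$ ($n$ copies) if $n\ge1$. For $\mathbf Y=(Y_1,\dots,Y_k)$ and $\mathbf u\in\mathbb N^k$, $\mathbf u\star\mathbf Y=u_1\star Y_1+\cdots+u_k\star Y_k$. $\Gamma\mathsf{Dom}$ is the set of maps $\boldsymbol\Gamma:\mathrm{Su}(\mathbb N)^k\to\mathrm{Su}(\mathbb N)^k$ of the form $\Gamma_i(\mathbf Y)=\bigcup_{\mathbf u\in\mathbb N^k}(\Gamma_{i,\mathbf u}+\mathbf u\star\mathbf Y)$, $1\le i\le k$, where the $\Gamma_{i,\mathbf u}$ are fixed subsets of $\mathbb N$. $\boldsymbol\Gamma^{(n)}$ is the $n$-fold composition ($\boldsymbol\Gamma^{(0)}$ the identity). $\boldsymbol\emptyset=(\emptyset,\dots,\emptyset)$. $\mathbf A\le\mathbf B$ means $A_i\subseteq B_i$ for all $i$. $\mathcal N(\mathbf A)=\{i:A_i=\emptyset\}$. -}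

module Defs where

open import Level using (0ℓ)
open import Data.Nat using (ℕ; zero; suc; _+_)
open import Data.Fin using (Fin; zero; suc)
open import Data.Product using (Σ; ∃; _×_; _,_)
open import Relation.Binary.PropositionalEquality using (_≡_)
open import Relation.Unary using (Pred; _⊆_; Empty; ｛_｝)
open import Function using (_⇔_)

Su : Set₁
Su = Pred ℕ 0ℓ

_⊕_ : Su → Su → Su
(A ⊕ B) n = Σ ℕ λ a → Σ ℕ λ b → A a × B b × n ≡ a + b

_⋆_ : ℕ → Su → Su
zero ⋆ B = ｛ 0 ｝
suc zero ⋆ B = B
suc (suc n) ⋆ B = B ⊕ (suc n ⋆ B)

Tup : ℕ → Set₁
Tup k = Fin k → Su

_⋆⋆_ : ∀ {k} → (Fin k → ℕ) → Tup k → Su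
_⋆⋆_ {zero}  u Y = ｛ 0 ｝
_⋆⋆_ {suc k} u Y = (u zero ⋆ Y zero) ⊕ ((λ i → u (suc i)) ⋆⋆ (λ i → Y (suc i)))

-- An element of ΓDom with k components is given by its coefficient
-- sets Γ_{i,u} ⊆ ℕ for 1 ≤ i ≤ k and u ∈ ℕ^k.
GammaDom : ℕ → Set₁
GammaDom k = Fin k → (Fin k → ℕ) → Su

apply : ∀ {k} → GammaDom k → Tup k → Tup k
apply Γ Y i n = Σ (Fin _ → ℕ) λ u → (Γ i u ⊕ (u ⋆⋆ Y)) n

iter : ∀ {k} → GammaDom k → ℕ → Tup k → Tup k
iter Γ zero Y = Y
iter Γ (suc n) Y = apply Γ (iter Γ n Y)

emptyTup : ∀ {k} → Tup k
emptyTup i n = Data.Empty.⊥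
  where import Data.Empty

_≤T_ : ∀ {k} → Tup k → Tup k → Set
A ≤T B = ∀ i → A i ⊆ B i

𝒩 : ∀ {k} → Tup k → Pred (Fin k) 0ℓ
𝒩 A i = Empty (A i)

_≡𝒩_ : ∀ {k} → Tup k → Tup k → Set
A ≡𝒩 B = ∀ i → 𝒩 A i ⇔ 𝒩 B i

module Submission where

-- Γ(A)_i is a union of sumsets, and a sumset is nonempty exactly when both summands are,
-- so whether Γ(A)_i is empty depends only on 𝒩(A); this gives (b) and, with monotonicity,
-- (c). For (d), the sets 𝒩(Γ^(m)(∅)) decrease in m, and once two consecutive ones agree
-- all later ones do. Call j born at m if it lies in 𝒩(Γ^(m)(∅)) but not in 𝒩(Γ^(m+1)(∅)).
-- A birth at m+1 forces a birth at m, and birth times are unique, so a birth at k would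
-- inject {0,…,k} into the k indices. Emptiness is not decidable, so the births are only
-- found under a double negation, which suffices because the goal is itself a negation.

open import Defs
open import Data.Nat using (ℕ; zero; suc; _+_; _≤_; _<_; z≤n; s≤s)
open import Data.Nat.Properties using (<-cmp; <-irrefl; m≤n⇒m<n∨m≡n; m≤m+n; +-comm)
open import Data.Fin using (Fin; zero; suc; toℕ)
open import Data.Fin.Properties using (injective⇒≤; toℕ-injective; toℕ≤pred[n])
open import Data.Product using (∃; _×_; _,_; proj₁; proj₂)
open import Data.Sum using (inj₁; inj₂)
open import Data.Empty using (⊥; ⊥-elim)
open import Function using (_∘′_; mk⇔; Equivalence)
open import Relation.Binary using (tri<; tri≈; tri>)
open import Relation.Binary.PropositionalEquality using (_≡_; refl; sym; subst)
open import Relation.Nullary using (¬_)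
open import Relation.Unary using (Empty; _⊆_)

⊕-mono : ∀ {A B C D : Su} → A ⊆ B → C ⊆ D → A ⊕ C ⊆ B ⊕ D
⊕-mono A⊆B C⊆D (a , c , a∈A , c∈C , n≡a+c) = a , c , A⊆B a∈A , C⊆D c∈C , n≡a+c

⋆-mono : ∀ n {A B : Su} → A ⊆ B → n ⋆ A ⊆ n ⋆ B
⋆-mono zero          A⊆B = λ x → x
⋆-mono (suc zero)    A⊆B = A⊆B
⋆-mono (suc (suc n)) A⊆B = ⊕-mono A⊆B (⋆-mono (suc n) A⊆B)

⋆⋆-mono : ∀ {k} (u : Fin k → ℕ) {A B : Tup k} → A ≤T B → u ⋆⋆ A ⊆ u ⋆⋆ B
⋆⋆-mono {zero}  u A≤B = λ x → x
⋆⋆-mono {suc k} u A≤B =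
  ⊕-mono (⋆-mono (u zero) (A≤B zero)) (⋆⋆-mono (λ i → u (suc i)) (λ i → A≤B (suc i)))

apply-mono : ∀ {k} (Γ : GammaDom k) {A B : Tup k} → A ≤T B → apply Γ A ≤T apply Γ B
apply-mono Γ A≤B i (u , x) = u , ⊕-mono (λ y → y) (⋆⋆-mono u A≤B) x

≤T⇒𝒩-anti : ∀ {k} {A B : Tup k} → A ≤T B → 𝒩 B ⊆ 𝒩 A
≤T⇒𝒩-anti A≤B {i} B-empty n n∈A = B-empty n (A≤B i n∈A)

⊕-Empty-mono : ∀ {A B C D : Su} →
  (Empty A → Empty B) → (Empty C → Empty D) → Empty (A ⊕ C) → Empty (B ⊕ D)
⊕-Empty-mono A→B C→D A⊕C-empty n (b , d , b∈B , d∈D , _) =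
  C→D (λ c c∈C → A→B (λ a a∈A → A⊕C-empty (a + c) (a , c , a∈A , c∈C , refl)) b b∈B) d d∈D

⋆-Empty-mono : ∀ n {A B : Su} → (Empty A → Empty B) → Empty (n ⋆ A) → Empty (n ⋆ B)
⋆-Empty-mono zero          A→B 0⋆A-empty = λ _ _ → 0⋆A-empty 0 refl
⋆-Empty-mono (suc zero)    A→B = A→B
⋆-Empty-mono (suc (suc n)) A→B = ⊕-Empty-mono A→B (⋆-Empty-mono (suc n) A→B)

⋆⋆-Empty-mono : ∀ {k} (u : Fin k → ℕ) {A B : Tup k} →
  𝒩 A ⊆ 𝒩 B → Empty (u ⋆⋆ A) → Empty (u ⋆⋆ B)
⋆⋆-Empty-mono {zero}  u 𝒩A⊆𝒩B u⋆⋆A-empty = λ _ _ → u⋆⋆A-empty 0 refl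
⋆⋆-Empty-mono {suc k} u 𝒩A⊆𝒩B =
  ⊕-Empty-mono (⋆-Empty-mono (u zero) 𝒩A⊆𝒩B) (⋆⋆-Empty-mono (λ i → u (suc i)) 𝒩A⊆𝒩B)

apply-𝒩-mono : ∀ {k} (Γ : GammaDom k) {A B : Tup k} →
  𝒩 A ⊆ 𝒩 B → 𝒩 (apply Γ A) ⊆ 𝒩 (apply Γ B)
apply-𝒩-mono Γ 𝒩A⊆𝒩B {i} ΓA-empty n (u , x) =
  ⊕-Empty-mono (λ e → e) (⋆⋆-Empty-mono u 𝒩A⊆𝒩B) (λ m y → ΓA-empty m (u , y)) n x

apply-≡𝒩-cong : ∀ {k} (Γ : GammaDom k) {A B : Tup k} → A ≡𝒩 B → apply Γ A ≡𝒩 apply Γ B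
apply-≡𝒩-cong Γ A≡B i = mk⇔ (apply-𝒩-mono Γ (λ {j} → Equivalence.to (A≡B j)))
                             (apply-𝒩-mono Γ (λ {j} → Equivalence.from (A≡B j)))

module Orbit {k} (Γ : GammaDom k) where

  orbit : ℕ → Tup k
  orbit m = iter Γ m emptyTup

  orbit-mono : ∀ {m n} → m ≤ n → orbit m ≤T orbit n
  orbit-mono z≤n       i ()
  orbit-mono (s≤s m≤n) = apply-mono Γ (orbit-mono m≤n)

  𝒩-orbit-anti : ∀ {m n} → m ≤ n → 𝒩 (orbit n) ⊆ 𝒩 (orbit m)
  𝒩-orbit-anti m≤n = ≤T⇒𝒩-anti (orbit-mono m≤n)

  𝒩-orbit-stable-propagates : ∀ {m} → 𝒩 (orbit m) ⊆ 𝒩 (orbit (suc m)) →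
    ∀ n → 𝒩 (orbit (n + m)) ⊆ 𝒩 (orbit (suc (n + m)))
  𝒩-orbit-stable-propagates stable zero    = stable
  𝒩-orbit-stable-propagates stable (suc n) = apply-𝒩-mono Γ (𝒩-orbit-stable-propagates stable n)

  𝒩-orbit-stable-from : ∀ {m} → 𝒩 (orbit m) ⊆ 𝒩 (orbit (suc m)) →
    ∀ n → 𝒩 (orbit m) ⊆ 𝒩 (orbit (n + m))
  𝒩-orbit-stable-from stable zero    = λ e → e
  𝒩-orbit-stable-from stable (suc n) =
    λ e → 𝒩-orbit-stable-propagates stable n (𝒩-orbit-stable-from stable n e)

  Born : ℕ → Fin k → Set
  Born m j = 𝒩 (orbit m) j × ¬ 𝒩 (orbit (suc m)) j

  born-before : ∀ {s t j} → s < t → Born s j → Born t j → ⊥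
  born-before s<t (_ , nonempty-after-s) (empty-at-t , _) =
    nonempty-after-s (𝒩-orbit-anti s<t empty-at-t)

  born-unique : ∀ {s t j} → Born s j → Born t j → s ≡ t
  born-unique {s} {t} bs bt with <-cmp s t
  ... | tri< s<t _ _ = ⊥-elim (born-before s<t bs bt)
  ... | tri≈ _ s≡t _ = s≡t
  ... | tri> _ _ t<s = ⊥-elim (born-before t<s bt bs)

  -- Without a birth at m, 𝒩 does not drop at m, hence neither at m + 1.
  born-pred : ∀ {m j} → Born (suc m) j → ¬ ¬ ∃ (Born m)
  born-pred {m} (empty , nonempty) no-birth = nonempty (apply-𝒩-mono Γ no-drop empty)
    where
    no-drop : 𝒩 (orbit m) ⊆ 𝒩 (orbit (suc m))
    no-drop {i} e n n∈X = no-birth (i , e , λ empty → empty n n∈X)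

  births-below : ∀ m {j} → Born m j → ¬ ¬ (∀ s → s ≤ m → ∃ (Born s))
  births-below zero    b all-born = all-born λ { zero z≤n → _ , b }
  births-below (suc m) b all-born =
    born-pred {m} b λ (_ , b′) → births-below m b′ λ below → all-born (extend below)
    where
    extend : (∀ s → s ≤ m → ∃ (Born s)) → ∀ s → s ≤ suc m → ∃ (Born s)
    extend below s s≤1+m with m≤n⇒m<n∨m≡n s≤1+m
    ... | inj₁ (s≤s s≤m) = below s s≤m
    ... | inj₂ refl      = _ , b

  births-bounded : ∀ {m} → (∀ s → s ≤ m → ∃ (Born s)) → suc m ≤ k
  births-bounded {m} born = injective⇒≤ born-index-injective
    where
    born-index : Fin (suc m) → Fin k
    born-index s = proj₁ (born (toℕ s) (toℕ≤pred[n] s))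

    born-index-injective : ∀ {s t} → born-index s ≡ born-index t → s ≡ t
    born-index-injective {s} {t} eq = toℕ-injective (born-unique
      (proj₂ (born (toℕ s) (toℕ≤pred[n] s)))
      (subst (Born (toℕ t)) (sym eq) (proj₂ (born (toℕ t) (toℕ≤pred[n] t)))))

  𝒩-orbit-stable-at-k : 𝒩 (orbit k) ⊆ 𝒩 (orbit (suc k))
  𝒩-orbit-stable-at-k empty n n∈X =
    births-below k (empty , λ e → e n n∈X) λ born → <-irrefl refl (births-bounded born)

  𝒩-orbit-constant-from-k : ∀ n → orbit k ≡𝒩 orbit (k + n)
  𝒩-orbit-constant-from-k n j = mk⇔
    (subst (λ t → 𝒩 (orbit t) j) (+-comm n k) ∘′ 𝒩-orbit-stable-from 𝒩-orbit-stable-at-k n)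
    (𝒩-orbit-anti (m≤m+n k n))

lemma3p3 : ∀ {k} (Γ : GammaDom k) →
    ((A B : Tup k) → A ≤T B → apply Γ A ≤T apply Γ B)
    × ((A B : Tup k) → A ≡𝒩 B → apply Γ A ≡𝒩 apply Γ B)
    × ((A B : Tup k) → A ≤T B → 𝒩 (apply Γ B) ⊆ 𝒩 (apply Γ A))
    × ((n : ℕ) → iter Γ k emptyTup ≡𝒩 iter Γ (k + n) emptyTup)
lemma3p3 Γ =
    (λ A B → apply-mono Γ)
  , (λ A B → apply-≡𝒩-cong Γ)
  , (λ A B A≤B → ≤T⇒𝒩-anti (apply-mono Γ A≤B))
  , Orbit.𝒩-orbit-constant-from-k Γ
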